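{- Let $\varepsilon>0$, let $k,t$ be positive integers, and let $H$ be a graph whose vertex set is partitioned as $V(H)=A\cup B_{1}\cup\dots\cup B_{k}$ with $|A|=|B_{1}|=\dots=|B_{k}|=t$. Let $d_1,\dots,d_k\ge 0$ be reals. Suppose that for every $i\in[k]$ the pair $(A,B_{i})$ is $\varepsilon$-uniform and $e(A,B_{i})\geq d_{i}t^{2}$. Then $H$ contains at least \[ t\left(e(A)-2\varepsilon t^{2}\right)\sum_{i=1}^{k}d_{i}^{2}-2\varepsilon k\,t\,e(A) \] triangles having exactly $2$ vertices in $A$.
   Context: For disjoint vertex sets $X,Y$ in a graph, $e(X,Y)$ is the number of edges with one endpoint in $X$ and one in $Y$, $e(X)$ is the number of edges with both endpoints in $X$, and $d(X,Y)=e(X,Y)/(|X||Y|)$ is the density. A pair $(A,B)$ of disjoint nonempty vertex sets is $\varepsilon$-uniform (in Szemerédi's sense) if for all $X\subseteq A$, $Y\subseteq B$ with $|X|\ge\varepsilon|A|$ and $|Y|\ge\varepsilon|B|$ one has $|d(X,Y)-d(A,B)|<\varepsilon$.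
   Formalization: The parameter ε and the numbers $d_1,\dots,d_k$ are rational rather than real. -}

module Defs where

open import Data.Nat as ℕ using (ℕ; zero; suc; _<ᵇ_)
open import Data.Fin using (Fin; toℕ)
open import Data.Bool using (Bool; true; false; _∧_; if_then_else_)
open import Data.List using (List; map; foldr; allFin)
open import Data.Product using (_×_; _,_)
open import Data.Sum using (_⊎_; inj₁; inj₂)
open import Data.Integer using (+_)
open import Data.Rational using (ℚ; _/_; 0ℚ; _+_; _-_; _*_; _≤_; _<_; ∣_∣)
open import Relation.Binary.PropositionalEquality using (_≡_)

b2n : Bool → ℕ
b2n true = 1
b2n false = 0

sumFin : (n : ℕ) → (Fin n → ℕ) → ℕ
sumFin n f = foldr ℕ._+_ 0 (map f (allFin n))

sumFinℚ : (n : ℕ) → (Fin n → ℚ) → ℚ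
sumFinℚ n f = foldr _+_ 0ℚ (map f (allFin n))

ℕ→ℚ : ℕ → ℚ
ℕ→ℚ n = (+ n) / 1

-- Vertex set  A ∪ B₁ ∪ … ∪ B_k  with |A| = |B_i| = t:
-- inj₁ a is the vertex a of A, inj₂ (i , b) is the vertex b of B_i.
Vertex : ℕ → ℕ → Set
Vertex k t = Fin t ⊎ (Fin k × Fin t)

record Graph (V : Set) : Set where
  field
    adj   : V → V → Bool
    sym   : ∀ u v → adj u v ≡ adj v u
    irrefl : ∀ v → adj v v ≡ false
open Graph public

Sub : ℕ → Set
Sub t = Fin t → Bool

size : {t : ℕ} → Sub t → ℕ
size {t} X = sumFin t (λ a → b2n (X a))

full : {t : ℕ} → Sub t
full _ = true

module _ {k t : ℕ} (H : Graph (Vertex k t)) where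

  eAB : Fin k → Sub t → Sub t → ℕ
  eAB i X Y = sumFin t (λ a → sumFin t (λ b →
                b2n (X a ∧ Y b ∧ adj H (inj₁ a) (inj₂ (i , b)))))

  eA : ℕ
  eA = sumFin t (λ a → sumFin t (λ a' →
         b2n ((toℕ a <ᵇ toℕ a') ∧ adj H (inj₁ a) (inj₁ a'))))

  triangles2A : ℕ
  triangles2A = sumFin t (λ a → sumFin t (λ a' → sumFin k (λ i → sumFin t (λ b →
      b2n ((toℕ a <ᵇ toℕ a') ∧ adj H (inj₁ a) (inj₁ a')
           ∧ adj H (inj₁ a) (inj₂ (i , b)) ∧ adj H (inj₁ a') (inj₂ (i , b)))))))

-- density e / (m n); the value for m n = 0 is an irrelevant convention
density : ℕ → ℕ → ℕ → ℚ
density e zero _ = 0ℚ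
density e (suc m) zero = 0ℚ
density e (suc m) (suc n) = (+ e) / (suc m ℕ.* suc n)

Uniform : {k t : ℕ} → Graph (Vertex k t) → ℚ → Fin k → Set
Uniform {k} {t} H ε i =
  (X Y : Sub t) →
  ε * ℕ→ℚ t ≤ ℕ→ℚ (size X) →
  ε * ℕ→ℚ t ≤ ℕ→ℚ (size Y) →
  ∣ density (eAB H i X Y) (size X) (size Y) - density (eAB H i full full) t t ∣ < ε

{-# OPTIONS --safe #-}
-- Fix a part B_i, let δ = d(A, B_i) and ρ = δ − ε. Uniformity of (A, B_i) leaves fewer than εt
-- low vertices in A, i.e. vertices with fewer than ρt neighbours in B_i, since together they would
-- have density at most δ − ε to B_i. Count each triangle a a′ b (a < a′ in A, b ∈ B_i) at a, as an
-- edge between the later A-neighbours N⁺(a) of a and its B_i-neighbours. If a is not low and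
-- |N⁺(a)| ≥ εt, uniformity gives more than ρ|N⁺(a)|·ρt such edges; the remaining vertices carry
-- at most 2εt² of the e(A) = Σ|N⁺(a)| edges of A. So, once ε ≤ ρ, at least ρ²t(e(A) − 2εt²)
-- of the triangles have their third vertex in B_i. To compare with d_i: if d_i² ≤ 2ε or
-- e(A) ≤ 2εt², the required t(e(A) − 2εt²)d_i² − 2εt e(A) is nonpositive. Otherwise d_i ≤ δ ≤ 1 gives d_i ≥ d_i² > 2ε,
-- hence ε ≤ d_i − ε ≤ ρ and ρ² ≥ (d_i − ε)² ≥ d_i² − 2ε.

module Submission where

open import Defs hiding (sym)
open import Data.Nat using (ℕ; suc)
open import Data.Fin using (Fin)
open import Data.Rational using (ℚ; 0ℚ; _*_; _-_; _≤_; _<_)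

open import Algebra.Bundles using (CommutativeRing)
import Algebra.Properties.Semiring.Sum as SemiringSum
open import Data.Bool using (true; false; _∧_)
open import Data.Bool.Properties using (∧-assoc)
open import Data.Fin using (zero; suc; toℕ)
import Data.Integer as ℤ
import Data.Integer.Properties as ℤ
open import Data.List as List using (allFin; tabulate)
open import Data.List.Properties using (map-tabulate)
open import Data.Nat using (zero; _<ᵇ_)
import Data.Nat as ℕ
import Data.Nat.Coprimality as Coprime
import Data.Nat.Properties as ℕ
open import Data.Product using (_,_)
open import Data.Rational
  using (_+_; -_; 1ℚ; ∣_∣; mkℚ; _/_; toℚᵘ; *≤*; *<*; nonNegative; positive)
open import Data.Rational.Properties
import Data.Rational.Unnormalised as ℚᵘ
import Data.Rational.Unnormalised.Properties as ℚᵘ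
open import Data.Sum using (_⊎_; inj₁; inj₂)
import Data.Vec.Functional as Vector
open import Data.Vec.Functional.Relation.Binary.Pointwise.Properties using (foldr-cong)
open import Function using (_∘_; id)
open import Level using (0ℓ)
open import Relation.Binary.PropositionalEquality
  using (_≡_; refl; sym; trans; cong; cong₂; subst; subst₂; module ≡-Reasoning)
open import Relation.Nullary using (Dec; yes; no; does; contradiction)
open import Relation.Nullary.Decidable using (dec⇒maybe)
open import Tactic.RingSolver using (solve-∀)
import Tactic.RingSolver.Core.AlmostCommutativeRing as ACR

ℚ-ring : ACR.AlmostCommutativeRing 0ℓ 0ℓ
ℚ-ring = ACR.fromCommutativeRing +-*-commutativeRing (λ p → dec⇒maybe (0ℚ ≟ p))

ℕ→ℚ≡mkℚ : ∀ n → ℕ→ℚ n ≡ mkℚ (ℤ.+ n) 0 (Coprime.sym (Coprime.1-coprimeTo n))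
ℕ→ℚ≡mkℚ n = normalize-coprime _

ℕ→ℚ-+ : ∀ m n → ℕ→ℚ (m ℕ.+ n) ≡ ℕ→ℚ m + ℕ→ℚ n
ℕ→ℚ-+ m n rewrite ℕ→ℚ≡mkℚ m | ℕ→ℚ≡mkℚ n =
  cong (_/ 1) (sym (cong₂ ℤ._+_ (ℤ.*-identityʳ (ℤ.+ m)) (ℤ.*-identityʳ (ℤ.+ n))))

ℕ→ℚ-* : ∀ m n → ℕ→ℚ (m ℕ.* n) ≡ ℕ→ℚ m * ℕ→ℚ n
ℕ→ℚ-* m n rewrite ℕ→ℚ≡mkℚ m | ℕ→ℚ≡mkℚ n = cong (_/ 1) (ℤ.pos-* m n)

ℕ→ℚ-mono-≤ : ∀ {m n} → m ℕ.≤ n → ℕ→ℚ m ≤ ℕ→ℚ n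
ℕ→ℚ-mono-≤ {m} {n} m≤n rewrite ℕ→ℚ≡mkℚ m | ℕ→ℚ≡mkℚ n =
  *≤* (subst₂ ℤ._≤_ (sym (ℤ.*-identityʳ (ℤ.+ m))) (sym (ℤ.*-identityʳ (ℤ.+ n))) (ℤ.+≤+ m≤n))

ℕ→ℚ-mono-< : ∀ {m n} → m ℕ.< n → ℕ→ℚ m < ℕ→ℚ n
ℕ→ℚ-mono-< {m} {n} m<n rewrite ℕ→ℚ≡mkℚ m | ℕ→ℚ≡mkℚ n =
  *<* (subst₂ ℤ._<_ (sym (ℤ.*-identityʳ (ℤ.+ m))) (sym (ℤ.*-identityʳ (ℤ.+ n))) (ℤ.+<+ m<n))

0≤ℕ→ℚ : ∀ n → 0ℚ ≤ ℕ→ℚ n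
0≤ℕ→ℚ n = ℕ→ℚ-mono-≤ {0} {n} ℕ.z≤n

0<ℕ→ℚ : ∀ n .{{_ : ℕ.NonZero n}} → 0ℚ < ℕ→ℚ n
0<ℕ→ℚ (suc n) = ℕ→ℚ-mono-< {0} {suc n} (ℕ.s≤s ℕ.z≤n)

0≤r⇒*-monoˡ-≤ : ∀ {r p q} → 0ℚ ≤ r → p ≤ q → r * p ≤ r * q
0≤r⇒*-monoˡ-≤ {r} 0≤r = *-monoˡ-≤-nonNeg r {{nonNegative 0≤r}}

0≤r⇒*-monoʳ-≤ : ∀ {r p q} → 0ℚ ≤ r → p ≤ q → p * r ≤ q * r
0≤r⇒*-monoʳ-≤ {r} 0≤r = *-monoʳ-≤-nonNeg r {{nonNegative 0≤r}}

0≤p*q : ∀ {p q} → 0ℚ ≤ p → 0ℚ ≤ q → 0ℚ ≤ p * q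
0≤p*q {p} {q} 0≤p 0≤q = subst (_≤ p * q) (*-zeroˡ q) (0≤r⇒*-monoʳ-≤ 0≤q 0≤p)

0<p*q : ∀ {p q} → 0ℚ < p → 0ℚ < q → 0ℚ < p * q
0<p*q {p} {q} 0<p 0<q = positive⁻¹ (p * q) {{pos*pos⇒pos p {{positive 0<p}} q {{positive 0<q}}}}

p≤q⇒p*p≤q*q : ∀ {p q} → 0ℚ ≤ p → p ≤ q → p * p ≤ q * q
p≤q⇒p*p≤q*q 0≤p p≤q = ≤-trans (0≤r⇒*-monoˡ-≤ 0≤p p≤q) (0≤r⇒*-monoʳ-≤ (≤-trans 0≤p p≤q) p≤q)

p≤p+q : ∀ {p q} → 0ℚ ≤ q → p ≤ p + q
p≤p+q {p} 0≤q = subst (_≤ p + _) (+-identityʳ p) (+-monoʳ-≤ p 0≤q)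

p≤q+p : ∀ {p q} → 0ℚ ≤ q → p ≤ q + p
p≤q+p {p} {q} 0≤q = subst (p ≤_) (+-comm p q) (p≤p+q 0≤q)

p-q≤p : ∀ {p q} → 0ℚ ≤ q → p - q ≤ p
p-q≤p {p} 0≤q = subst (p - _ ≤_) (+-identityʳ p) (+-monoʳ-≤ p (neg-antimono-≤ 0≤q))

p≤q+r⇒p-r≤q : ∀ {p q r} → p ≤ q + r → p - r ≤ q
p≤q+r⇒p-r≤q {p} {q} {r} p≤q+r = subst (p - r ≤_) (q+r-r≡q q r) (+-monoˡ-≤ (- r) p≤q+r)
  where
  q+r-r≡q : ∀ q r → q + r - r ≡ q
  q+r-r≡q = solve-∀ ℚ-ring

2p≤q⇒p≤q-p : ∀ {p q} → ℕ→ℚ 2 * p ≤ q → p ≤ q - p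
2p≤q⇒p≤q-p {p} {q} 2p≤q = subst (_≤ q - p) (2p-p≡p p) (+-monoˡ-≤ (- p) 2p≤q)
  where
  2p-p≡p : ∀ p → ℕ→ℚ 2 * p - p ≡ p
  2p-p≡p = solve-∀ ℚ-ring

p*p≤r*r+2q : ∀ {p q r} → 0ℚ ≤ q → 0ℚ ≤ p - q → p - q ≤ r → p ≤ 1ℚ → p * p ≤ r * r + ℕ→ℚ 2 * q
p*p≤r*r+2q {p} {q} {r} 0≤q 0≤p-q p-q≤r p≤1 = begin
  p * p                                   ≤⟨ p≤p+q (0≤p*q 0≤q 0≤q) ⟩
  p * p + q * q                           ≡⟨ square-shift p q ⟩
  (p - q) * (p - q) + ℕ→ℚ 2 * q * p       ≤⟨ +-mono-≤ (p≤q⇒p*p≤q*q 0≤p-q p-q≤r)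
                                                        (0≤r⇒*-monoˡ-≤ 0≤2q p≤1) ⟩
  r * r + ℕ→ℚ 2 * q * 1ℚ                  ≡⟨ cong (_+_ (r * r)) (*-identityʳ (ℕ→ℚ 2 * q)) ⟩
  r * r + ℕ→ℚ 2 * q                       ∎
  where
  open ≤-Reasoning
  0≤2q : 0ℚ ≤ ℕ→ℚ 2 * q
  0≤2q = 0≤p*q (0≤ℕ→ℚ 2) 0≤q
  square-shift : ∀ p q → p * p + q * q ≡ (p - q) * (p - q) + ℕ→ℚ 2 * q * p
  square-shift = solve-∀ ℚ-ring

p≤∣p∣ : ∀ p → p ≤ ∣ p ∣
p≤∣p∣ p with ≤-total 0ℚ p
... | inj₁ 0≤p = ≤-reflexive (sym (0≤p⇒∣p∣≡p 0≤p))
... | inj₂ p≤0 = ≤-trans p≤0 (0≤∣p∣ p)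

∣p-q∣<r⇒q-r<p : ∀ {p q r} → ∣ p - q ∣ < r → q - r < p
∣p-q∣<r⇒q-r<p {p} {q} {r} ∣p-q∣<r =
  subst₂ _<_ (lhs p q r) (rhs p r) (+-monoˡ-< (p - r) (≤-<-trans q-p≤∣p-q∣ ∣p-q∣<r))
  where
  q-p≤∣p-q∣ : - (p - q) ≤ ∣ p - q ∣
  q-p≤∣p-q∣ = subst (- (p - q) ≤_) (∣-p∣≡∣p∣ (p - q)) (p≤∣p∣ (- (p - q)))
  lhs : ∀ p q r → - (p - q) + (p - r) ≡ q - r
  lhs = solve-∀ ℚ-ring
  rhs : ∀ p r → r + (p - r) ≡ p
  rhs = solve-∀ ℚ-ring

/-*-ℕ→ℚ : ∀ e n .{{_ : ℕ.NonZero n}} → (ℤ.+ e / n) * ℕ→ℚ n ≡ ℕ→ℚ e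
/-*-ℕ→ℚ e n@(suc n-1) = toℚᵘ-injective (begin
  toℚᵘ (ℤ.+ e / n * ℕ→ℚ n)
    ≈⟨ toℚᵘ-homo-* (ℤ.+ e / n) (ℕ→ℚ n) ⟩
  toℚᵘ (ℤ.+ e / n) ℚᵘ.* toℚᵘ (ℕ→ℚ n)
    ≈⟨ ℚᵘ.*-cong (toℚᵘ-fromℚᵘ (ℚᵘ.mkℚᵘ (ℤ.+ e) n-1)) (toℚᵘ-cong (ℕ→ℚ≡mkℚ n)) ⟩
  ℚᵘ.mkℚᵘ (ℤ.+ e) n-1 ℚᵘ.* ℚᵘ.mkℚᵘ (ℤ.+ n) 0
    ≈⟨ ℚᵘ.*≡* (trans (ℤ.*-identityʳ (ℤ.+ e ℤ.* ℤ.+ n))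
                     (cong (λ m → ℤ.+ e ℤ.* ℤ.+ m) (sym (ℕ.*-identityʳ n)))) ⟩
  ℚᵘ.mkℚᵘ (ℤ.+ e) 0
    ≈⟨ toℚᵘ-cong (sym (ℕ→ℚ≡mkℚ e)) ⟩
  toℚᵘ (ℕ→ℚ e) ∎)
  where open ℚᵘ.≃-Reasoning

density-* : ∀ e m n .{{_ : ℕ.NonZero m}} .{{_ : ℕ.NonZero n}} →
  density e m n * (ℕ→ℚ m * ℕ→ℚ n) ≡ ℕ→ℚ e
density-* e m@(suc _) n@(suc _) =
  trans (cong (density e m n *_) (sym (ℕ→ℚ-* m n))) (/-*-ℕ→ℚ e (m ℕ.* n))

0<ℕ→ℚ*ℕ→ℚ : ∀ m n .{{_ : ℕ.NonZero m}} .{{_ : ℕ.NonZero n}} → 0ℚ < ℕ→ℚ m * ℕ→ℚ n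
0<ℕ→ℚ*ℕ→ℚ m n = 0<p*q (0<ℕ→ℚ m) (0<ℕ→ℚ n)

*-≤⇒≤-density : ∀ {p} e m n .{{_ : ℕ.NonZero m}} .{{_ : ℕ.NonZero n}} →
  p * (ℕ→ℚ m * ℕ→ℚ n) ≤ ℕ→ℚ e → p ≤ density e m n
*-≤⇒≤-density e m n p*mn≤e = *-cancelʳ-≤-pos (ℕ→ℚ m * ℕ→ℚ n) {{positive (0<ℕ→ℚ*ℕ→ℚ m n)}}
  (subst (_ ≤_) (sym (density-* e m n)) p*mn≤e)

density≤1 : ∀ e m n .{{_ : ℕ.NonZero m}} .{{_ : ℕ.NonZero n}} → e ℕ.≤ m ℕ.* n → density e m n ≤ 1ℚ
density≤1 e m n e≤mn = *-cancelʳ-≤-pos (ℕ→ℚ m * ℕ→ℚ n) {{positive (0<ℕ→ℚ*ℕ→ℚ m n)}} (begin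
  density e m n * (ℕ→ℚ m * ℕ→ℚ n)  ≡⟨ density-* e m n ⟩
  ℕ→ℚ e                             ≤⟨ ℕ→ℚ-mono-≤ e≤mn ⟩
  ℕ→ℚ (m ℕ.* n)                     ≡⟨ ℕ→ℚ-* m n ⟩
  ℕ→ℚ m * ℕ→ℚ n                     ≡⟨ *-identityˡ (ℕ→ℚ m * ℕ→ℚ n) ⟨
  1ℚ * (ℕ→ℚ m * ℕ→ℚ n)              ∎)
  where open ≤-Reasoning

<density⇒*<  : ∀ {p} e m n → 0ℚ < ℕ→ℚ m → 0ℚ < ℕ→ℚ n → p < density e m n → p * (ℕ→ℚ m * ℕ→ℚ n) < ℕ→ℚ e
<density⇒*< e zero n 0<0 _ _ = contradiction 0<0 (<-irrefl refl)
<density⇒*< e (suc m) zero _ 0<0 _ = contradiction 0<0 (<-irrefl refl)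
<density⇒*< {p} e m@(suc _) n@(suc _) _ _ p<d = begin-strict
  p * (ℕ→ℚ m * ℕ→ℚ n)               <⟨ *-monoˡ-<-pos (ℕ→ℚ m * ℕ→ℚ n) {{positive (0<ℕ→ℚ*ℕ→ℚ m n)}} p<d ⟩
  density e m n * (ℕ→ℚ m * ℕ→ℚ n)   ≡⟨ density-* e m n ⟩
  ℕ→ℚ e                              ∎
  where open ≤-Reasoning

module ℕΣ = SemiringSum ℕ.+-*-semiring
module ℚΣ = SemiringSum (CommutativeRing.semiring +-*-commutativeRing)

foldr-map-allFin : ∀ {A B : Set} (_∙_ : A → B → B) (z : B) n (f : Fin n → A) →
  List.foldr _∙_ z (List.map f (allFin n)) ≡ Vector.foldr _∙_ z f
foldr-map-allFin _∙_ z n f = trans (cong (List.foldr _∙_ z) (map-tabulate id f)) (foldr-tabulate f)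
  where
  foldr-tabulate : ∀ {m} g → List.foldr _∙_ z (tabulate {n = m} g) ≡ Vector.foldr _∙_ z g
  foldr-tabulate {zero} g = refl
  foldr-tabulate {suc m} g = cong (g zero ∙_) (foldr-tabulate (g ∘ suc))

sumFin≡∑ : ∀ n (f : Fin n → ℕ) → sumFin n f ≡ ℕΣ.sum f
sumFin≡∑ = foldr-map-allFin ℕ._+_ 0

sumFinℚ≡∑ : ∀ n (f : Fin n → ℚ) → sumFinℚ n f ≡ ℚΣ.sum f
sumFinℚ≡∑ = foldr-map-allFin _+_ 0ℚ

sumFin-cong : ∀ n {f g : Fin n → ℕ} → (∀ i → f i ≡ g i) → sumFin n f ≡ sumFin n g
sumFin-cong n {f} {g} f≗g = trans (sumFin≡∑ n f) (trans (ℕΣ.sum-cong-≗ f≗g) (sym (sumFin≡∑ n g)))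

sumFin-mono-≤ : ∀ n {f g : Fin n → ℕ} → (∀ i → f i ℕ.≤ g i) → sumFin n f ℕ.≤ sumFin n g
sumFin-mono-≤ n {f} {g} f≤g =
  subst₂ ℕ._≤_ (sym (sumFin≡∑ n f)) (sym (sumFin≡∑ n g))
    (foldr-cong {R = ℕ._≤_} {S = ℕ._≤_} ℕ.+-mono-≤ ℕ.≤-refl f≤g)

sumFin-const : ∀ n c → sumFin n (λ _ → c) ≡ n ℕ.* c
sumFin-const n c = trans (sumFin≡∑ n _) (∑-const n)
  where
  ∑-const : ∀ n → ℕΣ.sum {n} (λ _ → c) ≡ n ℕ.* c
  ∑-const zero = refl
  ∑-const (suc n) = cong (c ℕ.+_) (∑-const n)

sumFin-comm : ∀ m n (F : Fin m → Fin n → ℕ) →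
  sumFin m (λ a → sumFin n (F a)) ≡ sumFin n (λ b → sumFin m (λ a → F a b))
sumFin-comm m n F = begin
  sumFin m (λ a → sumFin n (F a))          ≡⟨ sumFin²≡∑² m n F ⟩
  ℕΣ.sum (λ a → ℕΣ.sum (F a))              ≡⟨ ℕΣ.∑-comm F ⟩
  ℕΣ.sum (λ b → ℕΣ.sum (λ a → F a b))      ≡⟨ sumFin²≡∑² n m (λ b a → F a b) ⟨
  sumFin n (λ b → sumFin m (λ a → F a b))  ∎
  where
  open ≡-Reasoning
  sumFin²≡∑² : ∀ m n (F : Fin m → Fin n → ℕ) →
    sumFin m (λ a → sumFin n (F a)) ≡ ℕΣ.sum (λ a → ℕΣ.sum (F a))
  sumFin²≡∑² m n F = trans (sumFin≡∑ m _) (ℕΣ.sum-cong-≗ (λ a → sumFin≡∑ n (F a)))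

ℕ→ℚ-sumFin : ∀ n (f : Fin n → ℕ) → ℕ→ℚ (sumFin n f) ≡ sumFinℚ n (ℕ→ℚ ∘ f)
ℕ→ℚ-sumFin n f = trans (cong ℕ→ℚ (sumFin≡∑ n f)) (trans (ℕ→ℚ-∑ n f) (sym (sumFinℚ≡∑ n _)))
  where
  ℕ→ℚ-∑ : ∀ n (f : Fin n → ℕ) → ℕ→ℚ (ℕΣ.sum f) ≡ ℚΣ.sum (ℕ→ℚ ∘ f)
  ℕ→ℚ-∑ zero f = refl
  ℕ→ℚ-∑ (suc n) f = trans (ℕ→ℚ-+ (f zero) _) (cong (ℕ→ℚ (f zero) +_) (ℕ→ℚ-∑ n (f ∘ suc)))

sumFinℚ-cong : ∀ n {f g : Fin n → ℚ} → (∀ i → f i ≡ g i) → sumFinℚ n f ≡ sumFinℚ n g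
sumFinℚ-cong n {f} {g} f≗g = trans (sumFinℚ≡∑ n f) (trans (ℚΣ.sum-cong-≗ f≗g) (sym (sumFinℚ≡∑ n g)))

sumFinℚ-mono-≤ : ∀ n {f g : Fin n → ℚ} → (∀ i → f i ≤ g i) → sumFinℚ n f ≤ sumFinℚ n g
sumFinℚ-mono-≤ n {f} {g} f≤g =
  subst₂ _≤_ (sym (sumFinℚ≡∑ n f)) (sym (sumFinℚ≡∑ n g))
    (foldr-cong {R = _≤_} {S = _≤_} +-mono-≤ ≤-refl f≤g)

sumFinℚ-+ : ∀ n (f g : Fin n → ℚ) → sumFinℚ n (λ i → f i + g i) ≡ sumFinℚ n f + sumFinℚ n g
sumFinℚ-+ n f g = begin
  sumFinℚ n (λ i → f i + g i)  ≡⟨ sumFinℚ≡∑ n _ ⟩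
  ℚΣ.sum (λ i → f i + g i)     ≡⟨ ℚΣ.∑-distrib-+ f g ⟩
  ℚΣ.sum f + ℚΣ.sum g          ≡⟨ cong₂ _+_ (sumFinℚ≡∑ n f) (sumFinℚ≡∑ n g) ⟨
  sumFinℚ n f + sumFinℚ n g    ∎
  where open ≡-Reasoning

sumFinℚ-*ˡ : ∀ n x (f : Fin n → ℚ) → sumFinℚ n (λ i → x * f i) ≡ x * sumFinℚ n f
sumFinℚ-*ˡ n x f =
  trans (sumFinℚ≡∑ n _) (trans (sym (ℚΣ.*-distribˡ-sum x f)) (cong (x *_) (sym (sumFinℚ≡∑ n f))))

sumFinℚ-*ʳ : ∀ n x (f : Fin n → ℚ) → sumFinℚ n (λ i → f i * x) ≡ sumFinℚ n f * x
sumFinℚ-*ʳ n x f =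
  trans (sumFinℚ≡∑ n _) (trans (sym (ℚΣ.*-distribʳ-sum x f)) (cong (_* x) (sym (sumFinℚ≡∑ n f))))

sumFinℚ-const : ∀ n x → sumFinℚ n (λ _ → x) ≡ ℕ→ℚ n * x
sumFinℚ-const n x = trans (sumFinℚ≡∑ n _) (∑-const n)
  where
  ∑-const : ∀ n → ℚΣ.sum {n} (λ _ → x) ≡ ℕ→ℚ n * x
  ∑-const zero = sym (*-zeroˡ x)
  ∑-const (suc n) = begin
    x + ℚΣ.sum {n} (λ _ → x)   ≡⟨ cong (x +_) (∑-const n) ⟩
    x + ℕ→ℚ n * x              ≡⟨ cong (_+ ℕ→ℚ n * x) (*-identityˡ x) ⟨
    1ℚ * x + ℕ→ℚ n * x         ≡⟨ *-distribʳ-+ x 1ℚ (ℕ→ℚ n) ⟨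
    (1ℚ + ℕ→ℚ n) * x           ≡⟨ cong (_* x) (ℕ→ℚ-+ 1 n) ⟨
    ℕ→ℚ (suc n) * x            ∎
    where open ≡-Reasoning

ℕ→ℚ-sumFin-*ʳ : ∀ n (f : Fin n → ℕ) x → sumFinℚ n (λ i → ℕ→ℚ (f i) * x) ≡ ℕ→ℚ (sumFin n f) * x
ℕ→ℚ-sumFin-*ʳ n f x = trans (sumFinℚ-*ʳ n x (ℕ→ℚ ∘ f)) (cong (_* x) (sym (ℕ→ℚ-sumFin n f)))

sumFinℚ-*ˡ-const : ∀ n x y (f : Fin n → ℚ) → sumFinℚ n (λ i → x * f i - y) ≡ x * sumFinℚ n f - ℕ→ℚ n * y
sumFinℚ-*ˡ-const n x y f = begin
  sumFinℚ n (λ i → x * f i - y)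
    ≡⟨ sumFinℚ-+ n (λ i → x * f i) (λ _ → - y) ⟩
  sumFinℚ n (λ i → x * f i) + sumFinℚ n (λ _ → - y)
    ≡⟨ cong₂ _+_ (sumFinℚ-*ˡ n x f) (sumFinℚ-const n (- y)) ⟩
  x * sumFinℚ n f + ℕ→ℚ n * - y
    ≡⟨ cong (_+_ (x * sumFinℚ n f)) (neg-distribʳ-* (ℕ→ℚ n) y) ⟨
  x * sumFinℚ n f - ℕ→ℚ n * y ∎
  where open ≡-Reasoning

b2n≤1 : ∀ b → b2n b ℕ.≤ 1
b2n≤1 true = ℕ.≤-refl
b2n≤1 false = ℕ.z≤n

size-full : ∀ {t} → size (full {t}) ≡ t
size-full {t} = trans (sumFin-const t 1) (ℕ.*-identityʳ t)

size≤ : ∀ {t} (X : Sub t) → size X ℕ.≤ t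
size≤ {t} X = subst (size X ℕ.≤_) size-full (sumFin-mono-≤ t (b2n≤1 ∘ X))

sumFin-b2n-∧ : ∀ n β (Y : Sub n) → sumFin n (λ b → b2n (β ∧ Y b)) ≡ b2n β ℕ.* size Y
sumFin-b2n-∧ n true Y = sym (ℕ.+-identityʳ (size Y))
sumFin-b2n-∧ n false Y = trans (sumFin-const n 0) (ℕ.*-zeroʳ n)

module _ {k t : ℕ} (H : Graph (Vertex k t)) where

  laterNbrs : Fin t → Sub t
  laterNbrs a a′ = (toℕ a <ᵇ toℕ a′) ∧ adj H (inj₁ a) (inj₁ a′)

  nbrsIn : Fin k → Fin t → Sub t
  nbrsIn i a b = adj H (inj₁ a) (inj₂ (i , b))

  trianglesOver : Fin k → ℕ
  trianglesOver i = sumFin t (λ a → eAB H i (laterNbrs a) (nbrsIn i a))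

  triangles2A≡∑trianglesOver : triangles2A H ≡ sumFin k trianglesOver
  triangles2A≡∑trianglesOver =
    trans (sumFin-cong t (λ a → sumFin-comm t k _))
    (trans (sumFin-comm t k _)
    (sumFin-cong k (λ i → sumFin-cong t (λ a → sumFin-cong t (λ a′ → sumFin-cong t (λ b →
      cong b2n (sym (∧-assoc (toℕ a <ᵇ toℕ a′) (adj H (inj₁ a) (inj₁ a′)) _))))))))

  eAB-full : ∀ i X → eAB H i X full ≡ sumFin t (λ a → b2n (X a) ℕ.* size (nbrsIn i a))
  eAB-full i X = sumFin-cong t (λ a → sumFin-b2n-∧ t (X a) (nbrsIn i a))

  eAB≤t*t : ∀ i X Y → eAB H i X Y ℕ.≤ t ℕ.* t
  eAB≤t*t i X Y = subst (eAB H i X Y ℕ.≤_) (sumFin-const t t)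
    (sumFin-mono-≤ t (λ a → size≤ (λ b → X a ∧ Y b ∧ adj H (inj₁ a) (inj₂ (i , b)))))

b2n[x<y]*x≤b2n[x<y]*y : ∀ {x y} (x<?y : Dec (x < y)) →
  ℕ→ℚ (b2n (does x<?y)) * x ≤ ℕ→ℚ (b2n (does x<?y)) * y
b2n[x<y]*x≤b2n[x<y]*y (yes x<y) = 0≤r⇒*-monoˡ-≤ (0≤ℕ→ℚ 1) (<⇒≤ x<y)
b2n[x<y]*x≤b2n[x<y]*y {x} {y} (no _) = ≤-reflexive (trans (*-zeroˡ x) (sym (*-zeroˡ y)))

module UniformPair {k t : ℕ} {{_ : ℕ.NonZero t}} (H : Graph (Vertex k t))
                   (ε : ℚ) (0<ε : 0ℚ < ε) (i : Fin k) (uniform : Uniform H ε i) where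

  δ : ℚ
  δ = density (eAB H i full full) t t

  ρ : ℚ
  ρ = δ - ε

  deg : Fin t → ℕ
  deg a = size (nbrsIn H i a)

  low : Sub t
  low a = does (ℕ→ℚ (deg a) <? ρ * ℕ→ℚ t)

  0<εt : 0ℚ < ε * ℕ→ℚ t
  0<εt = 0<p*q 0<ε (0<ℕ→ℚ t)

  uniform-lower : ∀ X Y → ε * ℕ→ℚ t ≤ ℕ→ℚ (size X) → ε * ℕ→ℚ t ≤ ℕ→ℚ (size Y) →
    ρ * (ℕ→ℚ (size X) * ℕ→ℚ (size Y)) < ℕ→ℚ (eAB H i X Y)
  uniform-lower X Y εt≤X εt≤Y = <density⇒*< (eAB H i X Y) (size X) (size Y)
    (<-≤-trans 0<εt εt≤X) (<-≤-trans 0<εt εt≤Y) (∣p-q∣<r⇒q-r<p (uniform X Y εt≤X εt≤Y))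

  eAB[low,full]≤ : ℕ→ℚ (eAB H i low full) ≤ ρ * (ℕ→ℚ (size low) * ℕ→ℚ (size {t} full))
  eAB[low,full]≤ = begin
    ℕ→ℚ (eAB H i low full)
      ≡⟨ cong ℕ→ℚ (eAB-full H i low) ⟩
    ℕ→ℚ (sumFin t (λ a → b2n (low a) ℕ.* deg a))
      ≡⟨ ℕ→ℚ-sumFin t _ ⟩
    sumFinℚ t (λ a → ℕ→ℚ (b2n (low a) ℕ.* deg a))
      ≡⟨ sumFinℚ-cong t (λ a → ℕ→ℚ-* (b2n (low a)) (deg a)) ⟩
    sumFinℚ t (λ a → ℕ→ℚ (b2n (low a)) * ℕ→ℚ (deg a))
      ≤⟨ sumFinℚ-mono-≤ t (λ a → b2n[x<y]*x≤b2n[x<y]*y (ℕ→ℚ (deg a) <? ρ * ℕ→ℚ t)) ⟩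
    sumFinℚ t (λ a → ℕ→ℚ (b2n (low a)) * (ρ * ℕ→ℚ t))
      ≡⟨ ℕ→ℚ-sumFin-*ʳ t (b2n ∘ low) (ρ * ℕ→ℚ t) ⟩
    ℕ→ℚ (size low) * (ρ * ℕ→ℚ t)
      ≡⟨ rearrange (ℕ→ℚ (size low)) ρ (ℕ→ℚ t) ⟩
    ρ * (ℕ→ℚ (size low) * ℕ→ℚ t)
      ≡⟨ cong (λ n → ρ * (ℕ→ℚ (size low) * ℕ→ℚ n)) (size-full {t}) ⟨
    ρ * (ℕ→ℚ (size low) * ℕ→ℚ (size {t} full)) ∎
    where
    open ≤-Reasoning
    rearrange : ∀ l r s → l * (r * s) ≡ r * (l * s)
    rearrange = solve-∀ ℚ-ring

  few-low : ℕ→ℚ (size low) < ε * ℕ→ℚ t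
  few-low = ≰⇒> λ εt≤low → <-irrefl refl (<-≤-trans (lower εt≤low) eAB[low,full]≤)
    where
    lower : ε * ℕ→ℚ t ≤ ℕ→ℚ (size low) →
      ρ * (ℕ→ℚ (size low) * ℕ→ℚ (size {t} full)) < ℕ→ℚ (eAB H i low full)
    lower εt≤low = uniform-lower low full εt≤low
      (≤-trans εt≤low (ℕ→ℚ-mono-≤ (subst (size low ℕ.≤_) (sym (size-full {t})) (size≤ low))))

  module _ (ε≤ρ : ε ≤ ρ) where

    0≤ρ : 0ℚ ≤ ρ
    0≤ρ = ≤-trans (<⇒≤ 0<ε) ε≤ρ

    κ : ℚ
    κ = ρ * ρ * ℕ→ℚ t

    0≤κ : 0ℚ ≤ κ
    0≤κ = 0≤p*q (0≤p*q 0≤ρ 0≤ρ) (0≤ℕ→ℚ t)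

    vertex-bound : ∀ a → ℕ→ℚ (size (laterNbrs H a)) * κ ≤
      ℕ→ℚ (eAB H i (laterNbrs H a) (nbrsIn H i a)) + (ε * ℕ→ℚ t * κ + ℕ→ℚ (b2n (low a)) * (ℕ→ℚ t * κ))
    vertex-bound a = by-cases (ℕ→ℚ (deg a) <? ρ * ℕ→ℚ t) (ε * ℕ→ℚ t ≤? ℕ→ℚ (size (laterNbrs H a)))
      where
      open ≤-Reasoning
      n̂ ê t̂ : ℚ
      n̂ = ℕ→ℚ (size (laterNbrs H a))
      ê = ℕ→ℚ (eAB H i (laterNbrs H a) (nbrsIn H i a))
      t̂ = ℕ→ℚ t
      0≤εtκ : 0ℚ ≤ ε * t̂ * κ
      0≤εtκ = 0≤p*q (<⇒≤ 0<εt) 0≤κ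
      0≤ê : 0ℚ ≤ ê
      0≤ê = 0≤ℕ→ℚ (eAB H i (laterNbrs H a) (nbrsIn H i a))
      by-cases : (low? : Dec (ℕ→ℚ (deg a) < ρ * t̂)) → Dec (ε * t̂ ≤ n̂) →
        n̂ * κ ≤ ê + (ε * t̂ * κ + ℕ→ℚ (b2n (does low?)) * (t̂ * κ))
      by-cases (yes _) _ = begin
        n̂ * κ                            ≤⟨ 0≤r⇒*-monoʳ-≤ 0≤κ (ℕ→ℚ-mono-≤ (size≤ (laterNbrs H a))) ⟩
        t̂ * κ                            ≡⟨ *-identityˡ (t̂ * κ) ⟨
        1ℚ * (t̂ * κ)                     ≤⟨ p≤q+p 0≤εtκ ⟩
        ε * t̂ * κ + 1ℚ * (t̂ * κ)         ≤⟨ p≤q+p 0≤ê ⟩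
        ê + (ε * t̂ * κ + 1ℚ * (t̂ * κ))   ∎
      by-cases (no _) (no εt≰n) = begin
        n̂ * κ                            ≤⟨ 0≤r⇒*-monoʳ-≤ 0≤κ (<⇒≤ (≰⇒> εt≰n)) ⟩
        ε * t̂ * κ                        ≡⟨ +-identityʳ (ε * t̂ * κ) ⟨
        ε * t̂ * κ + 0ℚ                   ≡⟨ cong (_+_ (ε * t̂ * κ)) (*-zeroˡ (t̂ * κ)) ⟨
        ε * t̂ * κ + 0ℚ * (t̂ * κ)         ≤⟨ p≤q+p 0≤ê ⟩
        ê + (ε * t̂ * κ + 0ℚ * (t̂ * κ))   ∎
      by-cases (no high) (yes εt≤n) = begin
        n̂ * κ                            ≡⟨ rearrange n̂ ρ t̂ ⟩
        ρ * (n̂ * (ρ * t̂))                ≤⟨ 0≤r⇒*-monoˡ-≤ 0≤ρ (0≤r⇒*-monoˡ-≤ 0≤n̂ ρt≤deg) ⟩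
        ρ * (n̂ * ℕ→ℚ (deg a))            <⟨ uniform-lower (laterNbrs H a) (nbrsIn H i a) εt≤n εt≤deg ⟩
        ê                                ≤⟨ p≤p+q (+-mono-≤ 0≤εtκ 0≤0*tκ) ⟩
        ê + (ε * t̂ * κ + 0ℚ * (t̂ * κ))   ∎
        where
        0≤n̂ : 0ℚ ≤ n̂
        0≤n̂ = 0≤ℕ→ℚ (size (laterNbrs H a))
        0≤0*tκ : 0ℚ ≤ 0ℚ * (t̂ * κ)
        0≤0*tκ = ≤-reflexive (sym (*-zeroˡ (t̂ * κ)))
        ρt≤deg : ρ * t̂ ≤ ℕ→ℚ (deg a)
        ρt≤deg = ≮⇒≥ high
        εt≤deg : ε * t̂ ≤ ℕ→ℚ (deg a)
        εt≤deg = ≤-trans (0≤r⇒*-monoʳ-≤ (0≤ℕ→ℚ t) ε≤ρ) ρt≤deg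
        rearrange : ∀ n r s → n * (r * r * s) ≡ r * (n * (r * s))
        rearrange = solve-∀ ℚ-ring

    ∑vertex-bound : ℕ→ℚ (eA H) * κ ≤ ℕ→ℚ (trianglesOver H i) +
      (ℕ→ℚ t * (ε * ℕ→ℚ t * κ) + ε * ℕ→ℚ t * (ℕ→ℚ t * κ))
    ∑vertex-bound = begin
      ℕ→ℚ (eA H) * κ
        ≡⟨ ℕ→ℚ-sumFin-*ʳ t (size ∘ laterNbrs H) κ ⟨
      sumFinℚ t (λ a → ℕ→ℚ (size (laterNbrs H a)) * κ)
        ≤⟨ sumFinℚ-mono-≤ t vertex-bound ⟩
      sumFinℚ t (λ a → ê a + (εtκ + ℕ→ℚ (b2n (low a)) * tκ))
        ≡⟨ sumFinℚ-+ t ê _ ⟩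
      sumFinℚ t ê + sumFinℚ t (λ a → εtκ + ℕ→ℚ (b2n (low a)) * tκ)
        ≡⟨ cong₂ _+_ (sym (ℕ→ℚ-sumFin t _)) (sumFinℚ-+ t _ _) ⟩
      T + (sumFinℚ t (λ _ → εtκ) + sumFinℚ t (λ a → ℕ→ℚ (b2n (low a)) * tκ))
        ≡⟨ cong (_+_ T) (cong₂ _+_ (sumFinℚ-const t εtκ) (ℕ→ℚ-sumFin-*ʳ t (b2n ∘ low) tκ)) ⟩
      T + (ℕ→ℚ t * εtκ + ℕ→ℚ (size low) * tκ)
        ≤⟨ +-monoʳ-≤ T (+-monoʳ-≤ (ℕ→ℚ t * εtκ) (0≤r⇒*-monoʳ-≤ (0≤p*q (0≤ℕ→ℚ t) 0≤κ) (<⇒≤ few-low))) ⟩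
      T + (ℕ→ℚ t * εtκ + ε * ℕ→ℚ t * tκ) ∎
      where
      open ≤-Reasoning
      T εtκ tκ : ℚ
      T = ℕ→ℚ (trianglesOver H i)
      εtκ = ε * ℕ→ℚ t * κ
      tκ = ℕ→ℚ t * κ
      ê : Fin t → ℚ
      ê a = ℕ→ℚ (eAB H i (laterNbrs H a) (nbrsIn H i a))

    ρ²-lower-bound : ρ * ρ * (ℕ→ℚ t * (ℕ→ℚ (eA H) - ℕ→ℚ 2 * ε * ℕ→ℚ (t ℕ.* t))) ≤ ℕ→ℚ (trianglesOver H i)
    ρ²-lower-bound = begin
      ρ * ρ * (t̂ * (Ê - ℕ→ℚ 2 * ε * ℕ→ℚ (t ℕ.* t)))
        ≡⟨ cong (λ s → ρ * ρ * (t̂ * (Ê - ℕ→ℚ 2 * ε * s))) (ℕ→ℚ-* t t) ⟩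
      ρ * ρ * (t̂ * (Ê - ℕ→ℚ 2 * ε * (t̂ * t̂)))
        ≡⟨ expand ρ t̂ Ê ε ⟩
      Ê * κ - (t̂ * (ε * t̂ * κ) + ε * t̂ * (t̂ * κ))
        ≤⟨ p≤q+r⇒p-r≤q ∑vertex-bound ⟩
      ℕ→ℚ (trianglesOver H i) ∎
      where
      open ≤-Reasoning
      t̂ Ê : ℚ
      t̂ = ℕ→ℚ t
      Ê = ℕ→ℚ (eA H)
      expand : ∀ r s E e → r * r * (s * (E - ℕ→ℚ 2 * e * (s * s))) ≡
        E * (r * r * s) - (s * (e * s * (r * r * s)) + e * s * (s * (r * r * s)))
      expand = solve-∀ ℚ-ring

  δ≤1 : δ ≤ 1ℚ
  δ≤1 = density≤1 (eAB H i full full) t t (eAB≤t*t H i full full)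

  module _ {d : ℚ} (0≤d : 0ℚ ≤ d) (d≤δ : d ≤ δ) (2ε<d*d : ℕ→ℚ 2 * ε < d * d) where

    d≤1 : d ≤ 1ℚ
    d≤1 = ≤-trans d≤δ δ≤1

    ε≤d-ε : ε ≤ d - ε
    ε≤d-ε = 2p≤q⇒p≤q-p (<⇒≤ (<-≤-trans 2ε<d*d d*d≤d))
      where
      d*d≤d : d * d ≤ d
      d*d≤d = subst (d * d ≤_) (*-identityʳ d) (0≤r⇒*-monoˡ-≤ 0≤d d≤1)

    d-ε≤ρ : d - ε ≤ ρ
    d-ε≤ρ = +-monoˡ-≤ (- ε) d≤δ

    ε≤ρ : ε ≤ ρ
    ε≤ρ = ≤-trans ε≤d-ε d-ε≤ρ

    d*d≤ρ*ρ+2ε : d * d ≤ ρ * ρ + ℕ→ℚ 2 * ε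
    d*d≤ρ*ρ+2ε = p*p≤r*r+2q (<⇒≤ 0<ε) (≤-trans (<⇒≤ 0<ε) ε≤d-ε) d-ε≤ρ d≤1

  d²-lower-bound : (d : ℚ) → 0ℚ ≤ d → d * ℕ→ℚ (t ℕ.* t) ≤ ℕ→ℚ (eAB H i full full) →
    ℕ→ℚ t * (ℕ→ℚ (eA H) - ℕ→ℚ 2 * ε * ℕ→ℚ (t ℕ.* t)) * (d * d) - ℕ→ℚ 2 * ε * ℕ→ℚ t * ℕ→ℚ (eA H)
      ≤ ℕ→ℚ (trianglesOver H i)
  d²-lower-bound d 0≤d d*t²≤e = p≤q+r⇒p-r≤q (by-cases (d * d ≤? ℕ→ℚ 2 * ε) (≤-total 0ℚ P))
    where
    open ≤-Reasoning
    t̂ Ê P Q T : ℚ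
    t̂ = ℕ→ℚ t
    Ê = ℕ→ℚ (eA H)
    P = t̂ * (Ê - ℕ→ℚ 2 * ε * ℕ→ℚ (t ℕ.* t))
    Q = ℕ→ℚ 2 * ε * t̂ * Ê
    T = ℕ→ℚ (trianglesOver H i)
    0≤2ε : 0ℚ ≤ ℕ→ℚ 2 * ε
    0≤2ε = 0≤p*q (0≤ℕ→ℚ 2) (<⇒≤ 0<ε)
    0≤d*d : 0ℚ ≤ d * d
    0≤d*d = 0≤p*q 0≤d 0≤d
    0≤Q : 0ℚ ≤ Q
    0≤Q = 0≤p*q (0≤p*q 0≤2ε (0≤ℕ→ℚ t)) (0≤ℕ→ℚ (eA H))
    P≤tÊ : P ≤ t̂ * Ê
    P≤tÊ = 0≤r⇒*-monoˡ-≤ (0≤ℕ→ℚ t) (p-q≤p (0≤p*q 0≤2ε (0≤ℕ→ℚ (t ℕ.* t))))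
    tÊ2ε≡Q : t̂ * Ê * (ℕ→ℚ 2 * ε) ≡ Q
    tÊ2ε≡Q = rearrange t̂ Ê ε
      where
      rearrange : ∀ s E e → s * E * (ℕ→ℚ 2 * e) ≡ ℕ→ℚ 2 * e * s * E
      rearrange = solve-∀ ℚ-ring
    d≤δ : d ≤ δ
    d≤δ = *-≤⇒≤-density (eAB H i full full) t t
      (subst (λ s → d * s ≤ ℕ→ℚ (eAB H i full full)) (ℕ→ℚ-* t t) d*t²≤e)
    by-cases : Dec (d * d ≤ ℕ→ℚ 2 * ε) → 0ℚ ≤ P ⊎ P ≤ 0ℚ → P * (d * d) ≤ T + Q
    by-cases (yes d*d≤2ε) _ = begin
      P * (d * d)          ≤⟨ 0≤r⇒*-monoʳ-≤ 0≤d*d P≤tÊ ⟩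
      t̂ * Ê * (d * d)      ≤⟨ 0≤r⇒*-monoˡ-≤ (0≤p*q (0≤ℕ→ℚ t) (0≤ℕ→ℚ (eA H))) d*d≤2ε ⟩
      t̂ * Ê * (ℕ→ℚ 2 * ε)  ≡⟨ tÊ2ε≡Q ⟩
      Q                    ≤⟨ p≤q+p (0≤ℕ→ℚ (trianglesOver H i)) ⟩
      T + Q                ∎
    by-cases (no _) (inj₂ P≤0) = begin
      P * (d * d)          ≤⟨ 0≤r⇒*-monoʳ-≤ 0≤d*d P≤0 ⟩
      0ℚ * (d * d)         ≡⟨ *-zeroˡ (d * d) ⟩
      0ℚ                   ≤⟨ +-mono-≤ (0≤ℕ→ℚ (trianglesOver H i)) 0≤Q ⟩
      T + Q                ∎
    by-cases (no d*d≰2ε) (inj₁ 0≤P) = begin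
      P * (d * d)                    ≤⟨ 0≤r⇒*-monoˡ-≤ 0≤P (d*d≤ρ*ρ+2ε 0≤d d≤δ 2ε<d*d) ⟩
      P * (ρ * ρ + ℕ→ℚ 2 * ε)        ≡⟨ *-distribˡ-+ P (ρ * ρ) (ℕ→ℚ 2 * ε) ⟩
      P * (ρ * ρ) + P * (ℕ→ℚ 2 * ε)  ≡⟨ cong (_+ P * (ℕ→ℚ 2 * ε)) (*-comm P (ρ * ρ)) ⟩
      ρ * ρ * P + P * (ℕ→ℚ 2 * ε)    ≤⟨ +-mono-≤ (ρ²-lower-bound (ε≤ρ 0≤d d≤δ 2ε<d*d)) P*2ε≤Q ⟩
      T + Q                          ∎
      where
      2ε<d*d : ℕ→ℚ 2 * ε < d * d
      2ε<d*d = ≰⇒> d*d≰2ε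
      P*2ε≤Q : P * (ℕ→ℚ 2 * ε) ≤ Q
      P*2ε≤Q = ≤-trans (0≤r⇒*-monoʳ-≤ 0≤2ε P≤tÊ) (≤-reflexive tÊ2ε≡Q)

lemma2 : (ε : ℚ) → 0ℚ < ε → (k t : ℕ) → 1 Data.Nat.≤ k → 1 Data.Nat.≤ t →
    (H : Graph (Vertex k t)) → (d : Fin k → ℚ) → (∀ i → 0ℚ ≤ d i) →
    (∀ i → Uniform H ε i) →
    (∀ i → d i * ℕ→ℚ (t Data.Nat.* t) ≤ ℕ→ℚ (eAB H i full full)) →
    ℕ→ℚ t * (ℕ→ℚ (eA H) - ℕ→ℚ 2 * ε * ℕ→ℚ (t Data.Nat.* t)) * sumFinℚ k (λ i → d i * d i)
      - ℕ→ℚ 2 * ε * ℕ→ℚ k * ℕ→ℚ t * ℕ→ℚ (eA H)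
      ≤ ℕ→ℚ (triangles2A H)
lemma2 ε 0<ε k t _ 1≤t H d 0≤d uniform d*t²≤e = begin
  P * sumFinℚ k (λ i → d i * d i) - ℕ→ℚ 2 * ε * ℕ→ℚ k * ℕ→ℚ t * Ê
    ≡⟨ cong (_-_ (P * sumFinℚ k (λ i → d i * d i))) (rearrange ε (ℕ→ℚ k) (ℕ→ℚ t) Ê) ⟩
  P * sumFinℚ k (λ i → d i * d i) - ℕ→ℚ k * Q
    ≡⟨ sumFinℚ-*ˡ-const k P Q (λ i → d i * d i) ⟨
  sumFinℚ k (λ i → P * (d i * d i) - Q)
    ≤⟨ sumFinℚ-mono-≤ k (λ i → d²-lower-bound H ε 0<ε i (uniform i) (d i) (0≤d i) (d*t²≤e i)) ⟩
  sumFinℚ k (ℕ→ℚ ∘ trianglesOver H)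
    ≡⟨ trans (cong ℕ→ℚ (triangles2A≡∑trianglesOver H)) (ℕ→ℚ-sumFin k _) ⟨
  ℕ→ℚ (triangles2A H) ∎
  where
  open ≤-Reasoning
  open UniformPair using (d²-lower-bound)
  instance
    t≢0 : ℕ.NonZero t
    t≢0 = ℕ.>-nonZero 1≤t
  Ê P Q : ℚ
  Ê = ℕ→ℚ (eA H)
  P = ℕ→ℚ t * (Ê - ℕ→ℚ 2 * ε * ℕ→ℚ (t ℕ.* t))
  Q = ℕ→ℚ 2 * ε * ℕ→ℚ t * Ê
  rearrange : ∀ e k t E → ℕ→ℚ 2 * e * k * t * E ≡ k * (ℕ→ℚ 2 * e * t * E)
  rearrange = solve-∀ ℚ-ring
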